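{- Let $U=\{u_1,\dots,u_{3n}\}$ and let $\mathcal{X}=\{X_1,\dots,X_m\}$ be a family of $3$-element subsets of $U$. Construct the graph $G$ as follows: take a clique on vertices $Q=\{q_0,q_1,\dots,q_{3n}\}$; for each $i\in[m]$ add vertices $v_i,v_i^1,v_i^2,v_i^3,v_i^4$, where $v_i$ is adjacent to $q_j$ for each $j$ with $u_j\in X_i$, and each $v_i^\ell$ ($\ell\in\{1,2,3,4\}$) has neighborhood exactly $\{v_i\}\cup\{q_j : u_j\in X_i\}$. Let $S=\{v_i^\ell : i\in[m],\ \ell\in\{1,2,3,4\}\}$ and $b=4n$. Then there is a subfamily of $\mathcal{X}$ consisting of exactly $n$ sets whose union is $U$ if and only if some vertex cover of $G$ is reachable from $S$ in at most $b$ steps.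
   Context: A configuration is a vertex subset of $G$ (tokens on vertices). Two configurations $S,S'$ are adjacent if $S'=(S\setminus\{x\})\cup\{y\}$ for some $x\in S$, $y\in V(G)\setminus S$ with $xy\in E(G)$; a configuration is reachable from $S$ in $\ell$ steps if it is obtained from $S$ by a sequence of $\ell$ such moves. -}

module Defs where

open import Data.Nat using (ℕ; suc; _*_; _≤_)
open import Data.Fin using (Fin)
open import Data.Fin.Subset using (Subset; _∈_; ∣_∣)
open import Data.Bool using (Bool; true; false)
open import Data.Product using (Σ; _×_; ∃; ∃-syntax)
open import Data.Sum using (_⊎_)
open import Relation.Binary.PropositionalEquality using (_≡_; _≢_)
open import Relation.Nullary using (¬_)

-- Ground set U = {u_1,…,u_{3n}} is Fin (3 * n) (u_{j+1} ↔ j).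
-- A family X_1..X_m of subsets of U: Fin m → Subset (3 * n).

data V (n m : ℕ) : Set where
  q : Fin (suc (3 * n)) → V n m          -- q_0 … q_{3n}; q (suc j) corresponds to u_{j+1}
  v : Fin m → V n m
  w : Fin m → Fin 4 → V n m               -- v_i^ℓ

-- Edges of G (undirected; both orientations listed).
data Adj {n m : ℕ} (X : Fin m → Subset (3 * n)) : V n m → V n m → Set where
  qq : ∀ {a b} → a ≢ b → Adj X (q a) (q b)
  vq : ∀ {i j} → j ∈ X i → Adj X (v i) (q (Fin.suc j))
  qv : ∀ {i j} → j ∈ X i → Adj X (q (Fin.suc j)) (v i)
  wv : ∀ {i l} → Adj X (w i l) (v i)
  vw : ∀ {i l} → Adj X (v i) (w i l)
  wq : ∀ {i l j} → j ∈ X i → Adj X (w i l) (q (Fin.suc j))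
  qw : ∀ {i l j} → j ∈ X i → Adj X (q (Fin.suc j)) (w i l)

Config : ℕ → ℕ → Set
Config n m = V n m → Bool

Move : ∀ {n m} → (Fin m → Subset (3 * n)) → Config n m → Config n m → Set
Move {n} {m} X S S' = Σ (V n m) λ x → Σ (V n m) λ y →
  (S x ≡ true) × (S y ≡ false) × Adj X x y ×
  (S' x ≡ false) × (S' y ≡ true) × (∀ z → z ≢ x → z ≢ y → S' z ≡ S z)

data Reach {n m : ℕ} (X : Fin m → Subset (3 * n)) : ℕ → Config n m → Config n m → Set where
  done : ∀ {S} → Reach X 0 S S
  step : ∀ {ℓ S S' S''} → Move X S S' → Reach X ℓ S' S'' → Reach X (suc ℓ) S S''

IsVertexCover : ∀ {n m} → (Fin m → Subset (3 * n)) → Config n m → Set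
IsVertexCover X C = ∀ x y → Adj X x y → (C x ≡ true) ⊎ (C y ≡ true)

initS : ∀ {n m} → Config n m
initS (q _) = false
initS (v _) = false
initS (w _ _) = true

HasCover : ∀ {n m} → (Fin m → Subset (3 * n)) → Set
HasCover {n} {m} X = Σ (Subset m) λ T → (∣ T ∣ ≡ n) × (∀ u → ∃[ i ] (i ∈ T × u ∈ X i))

{-# OPTIONS --safe #-}
module Submission where

-- Forward: if the n sets X_i (i ∈ T) cover U, slide the token of v_i^1 to v_i for each i ∈ T,
-- and for each u_j the token of a further leaf of a chosen X_i ∋ u_j (i ∈ T) to q_j.  These 4n
-- slides use distinct sources and targets, so they can be made one after the other; afterwards
-- q_1 … q_{3n} and every v_i with i ∈ T are occupied, and every other gadget keeps its four leaves.
--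
-- Backward: give q_0 level 2, q_j (j ≥ 1) and v_i level 1 and the leaves level 0.  Levels of
-- adjacent vertices differ by at most one upwards, so ℓ moves raise the total level of the tokens
-- by at most ℓ, while the number of tokens stays 4m.  In a vertex cover C the clique carries
-- k ≥ 3n tokens, and a gadget whose v_i is empty keeps all four leaves; counting tokens gives
-- k ≤ 3t, where t is the number of occupied v_i.  So 4n ≤ [q_0 ∈ C] + k + t ≤ ℓ ≤ 4n:
-- q_0 is empty, t = n, and every move raises the level by exactly one.  Such a move enters q_j only from a leaf
-- of a gadget i with u_j ∈ X_i and never refills a leaf; hence every q_j keeps an emptied leaf of
-- such a gadget, whose v_i must be in C.  The n sets with v_i ∈ C therefore cover U.

open import Defs
open import Algebra.Properties.CommutativeSemigroup using (xy∙z≈xz∙y)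
open import Data.Bool using (Bool; true; false; if_then_else_)
open import Data.Bool.Properties using (if-eta)
open import Data.Fin using (Fin; zero; suc; cast; toℕ; punchIn; _≟_)
open import Data.Fin.Properties using (suc-injective; punchInᵢ≢i; toℕ-cast; toℕ-injective)
open import Data.Fin.Subset using (Subset; ⊤; _∈_; _∉_; ∣_∣)
open import Data.Fin.Subset.Properties using (∈⊤; ∣⊤∣≡n; _∈?_)
open import Data.Nat using (ℕ; zero; suc; _+_; _*_; _≤_; z≤n; s≤s)
open import Data.Nat.Properties
  using (+-*-semiring; +-commutativeSemigroup; +-assoc; +-comm; +-suc; +-identityʳ;
         +-cancelˡ-≡; +-cancelʳ-≡; +-cancelˡ-≤; +-cancelʳ-≤;
         +-mono-≤; +-monoˡ-≤; +-monoʳ-≤; *-cancelˡ-≤;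
         ≤-refl; ≤-reflexive; ≤-trans; ≤-antisym; m≤n+m; m≤n⇒m≤1+n; n≤0⇒n≡0; 0≢1+n;
         module ≤-Reasoning)
open import Data.Product using (∃-syntax; _×_; _,_; proj₁; proj₂)
open import Data.Sum using (_⊎_; inj₁; inj₂; [_,_])
open import Data.Vec using ([]; _∷_; here; there; tabulate)
open import Data.Vec.Properties using (lookup∘tabulate; lookup⇒[]=)
open import Function using (id; _∘_)
open import Function.Bundles using (_⇔_; mk⇔)
open import Function.Definitions using (Injective)
open import Relation.Binary.Definitions using (DecidableEquality)
open import Relation.Binary.PropositionalEquality
  using (_≡_; _≢_; refl; sym; trans; cong; cong₂; subst; subst₂; module ≡-Reasoning)
open import Relation.Nullary using (yes; no; does; contradiction)
open import Relation.Nullary.Decidable using (map′; dec-true; dec-false; _×-dec_)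
open import Algebra.Properties.Semiring.Sum +-*-semiring
  using (sum; sum-syntax; sum-cong-≗; sum-remove; sum-replicate-zero; ∑-distrib-+; *-distribˡ-sum)

⟦_⟧ : Bool → ℕ
⟦ b ⟧ = if b then 1 else 0

count : ∀ {K} → (Fin K → Bool) → ℕ
count {K} f = ∑[ k < K ] ⟦ f k ⟧

+-shiftˡ : ∀ {A A' B B' a b} → A + a ≡ A' + b → B ≡ B' → A + B + a ≡ A' + B' + b
+-shiftˡ {A} {A'} {B} {_} {a} {b} e refl =
  trans (xy∙z≈xz∙y +-commutativeSemigroup A B a)
        (trans (cong (_+ B) e) (sym (xy∙z≈xz∙y +-commutativeSemigroup A' B b)))

+-shiftʳ : ∀ {A A' B B' a b} → A ≡ A' → B + a ≡ B' + b → A + B + a ≡ A' + B' + b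
+-shiftʳ {A} {_} {B} {B'} {a} {b} refl e =
  trans (+-assoc A B a) (trans (cong (A +_) e) (sym (+-assoc A B' b)))

∑-shift : ∀ {N} {f g : Fin N → ℕ} (k : Fin N) {a b} →
          (∀ j → j ≢ k → f j ≡ g j) → f k + a ≡ g k + b → sum f + a ≡ sum g + b
∑-shift {zero} ()
∑-shift {suc N} {f} {g} k {a} {b} agree e = begin
  sum f + a                      ≡⟨ cong (_+ a) (sum-remove {i = k} f) ⟩
  f k + sum (f ∘ punchIn k) + a  ≡⟨ +-shiftˡ {f k} {g k} {sum (f ∘ punchIn k)} {sum (g ∘ punchIn k)}
                                       e (sum-cong-≗ λ j → agree (punchIn k j) (punchInᵢ≢i k j)) ⟩
  g k + sum (g ∘ punchIn k) + b  ≡⟨ cong (_+ b) (sum-remove {i = k} g) ⟨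
  sum g + b                      ∎
  where open ≡-Reasoning

∑-mono : ∀ {N} {f g : Fin N → ℕ} → (∀ k → f k ≤ g k) → sum f ≤ sum g
∑-mono {zero} _ = z≤n
∑-mono {suc N} f≤g = +-mono-≤ (f≤g zero) (∑-mono (f≤g ∘ suc))

count-all : ∀ {K} {f : Fin K → Bool} → (∀ k → f k ≡ true) → count f ≡ K
count-all {zero} _ = refl
count-all {suc K} all rewrite all zero = cong suc (count-all (all ∘ suc))

clique-cover-count : ∀ {N} (f : Fin (suc N) → Bool) →
                     (∀ a b → a ≢ b → f a ≡ true ⊎ f b ≡ true) → N ≤ count f
clique-cover-count {zero} _ _ = z≤n
clique-cover-count {suc N} f cover with f zero in f0
... | true = s≤s (clique-cover-count (f ∘ suc) λ a b a≢b →
                                       cover (suc a) (suc b) (a≢b ∘ suc-injective))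
... | false = ≤-reflexive (sym (count-all others))
  where
    others : ∀ a → f (suc a) ≡ true
    others a = [ (λ f0≡true → contradiction (trans (sym f0) f0≡true) λ ()) , id ]
                 (cover zero (suc a) λ ())

∣tabulate∣≡count : ∀ {K} (f : Fin K → Bool) → ∣ tabulate f ∣ ≡ count f
∣tabulate∣≡count {zero} f = refl
∣tabulate∣≡count {suc K} f with f zero
... | true = cong suc (∣tabulate∣≡count (f ∘ suc))
... | false = ∣tabulate∣≡count (f ∘ suc)

∈-tabulate : ∀ {K} {f : Fin K → Bool} {k} → f k ≡ true → k ∈ tabulate f
∈-tabulate {f = f} {k} fk = lookup⇒[]= k (tabulate f) (trans (lookup∘tabulate f k) fk)

rank : ∀ {K} (p : Subset K) {j} → j ∈ p → Fin ∣ p ∣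
rank (true ∷ p) here = zero
rank (true ∷ p) (there j∈p) = suc (rank p j∈p)
rank (false ∷ p) (there j∈p) = rank p j∈p

rank-injective : ∀ {K} (p : Subset K) {j j'} (j∈p : j ∈ p) (j'∈p : j' ∈ p) →
                 rank p j∈p ≡ rank p j'∈p → j ≡ j'
rank-injective (true ∷ p) here here _ = refl
rank-injective (true ∷ p) here (there _) ()
rank-injective (true ∷ p) (there _) here ()
rank-injective (true ∷ p) (there j∈p) (there j'∈p) e =
  cong suc (rank-injective p j∈p j'∈p (suc-injective e))
rank-injective (false ∷ p) (there j∈p) (there j'∈p) e = cong suc (rank-injective p j∈p j'∈p e)

module _ {n m : ℕ} where

  infix 4 _≟V_
  _≟V_ : DecidableEquality (V n m)
  q a ≟V q b = map′ (cong q) (λ { refl → refl }) (a ≟ b)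
  v i ≟V v j = map′ (cong v) (λ { refl → refl }) (i ≟ j)
  w i l ≟V w j l' =
    map′ (λ { (refl , refl) → refl }) (λ { refl → refl , refl }) (i ≟ j ×-dec l ≟ l')
  q _ ≟V v _ = no λ ()
  q _ ≟V w _ _ = no λ ()
  v _ ≟V q _ = no λ ()
  v _ ≟V w _ _ = no λ ()
  w _ _ ≟V q _ = no λ ()
  w _ _ ≟V v _ = no λ ()

  w-injective : ∀ {i i' l l'} → w {n} {m} i l ≡ w i' l' → i ≡ i' × l ≡ l'
  w-injective refl = refl , refl

  _[_]≔_ : Config n m → V n m → Bool → Config n m
  (S [ x ]≔ b) z = if does (z ≟V x) then b else S z

  ≔-same : ∀ S x b → (S [ x ]≔ b) x ≡ b
  ≔-same S x b rewrite dec-true (x ≟V x) refl = refl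

  ≔-other : ∀ S {x z} b → z ≢ x → (S [ x ]≔ b) z ≡ S z
  ≔-other S {x} {z} b z≢x rewrite dec-false (z ≟V x) z≢x = refl

  occupied≢vacant : ∀ {S : Config n m} {x y} → S x ≡ true → S y ≡ false → x ≢ y
  occupied≢vacant Sx Sy refl = contradiction (trans (sym Sx) Sy) λ ()

  moveToken : Config n m → V n m → V n m → Config n m
  moveToken S x y = (S [ x ]≔ false) [ y ]≔ true

  moveToken-other : ∀ {S x y z} → z ≢ x → z ≢ y → moveToken S x y z ≡ S z
  moveToken-other {S} {x} z≢x z≢y =
    trans (≔-other (S [ x ]≔ false) true z≢y) (≔-other S false z≢x)

  ∑Q ∑G : (V n m → ℕ) → ℕ
  ∑Q f = ∑[ a < suc (3 * n) ] f (q a)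
  ∑G f = ∑[ i < m ] (f (v i) + ∑[ l < 4 ] f (w i l))

  ∑V : (V n m → ℕ) → ℕ
  ∑V f = ∑Q f + ∑G f

  ∑V-shift : ∀ {f g : V n m → ℕ} x {a b} →
             (∀ z → z ≢ x → f z ≡ g z) → f x + a ≡ g x + b → ∑V f + a ≡ ∑V g + b
  ∑V-shift {f} {g} (q k) agree e =
    +-shiftˡ {∑Q f} {∑Q g} {∑G f} {∑G g}
      (∑-shift k (λ j j≢k → agree (q j) λ { refl → j≢k refl }) e)
      (sum-cong-≗ λ i → cong₂ _+_ (agree (v i) λ ()) (sum-cong-≗ λ l → agree (w i l) λ ()))
  ∑V-shift {f} {g} (v i) agree e =
    +-shiftʳ {∑Q f} {∑Q g} {∑G f} {∑G g}
      (sum-cong-≗ λ k → agree (q k) λ ())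
      (∑-shift i (λ j j≢i → cong₂ _+_ (agree (v j) λ { refl → j≢i refl })
                                      (sum-cong-≗ λ l → agree (w j l) λ ()))
        (+-shiftˡ {f (v i)} {g (v i)} {∑[ l < 4 ] f (w i l)} {∑[ l < 4 ] g (w i l)}
          e (sum-cong-≗ λ l → agree (w i l) λ ())))
  ∑V-shift {f} {g} (w i l) agree e =
    +-shiftʳ {∑Q f} {∑Q g} {∑G f} {∑G g}
      (sum-cong-≗ λ k → agree (q k) λ ())
      (∑-shift i (λ j j≢i → cong₂ _+_ (agree (v j) λ ())
                                      (sum-cong-≗ λ l' → agree (w j l') λ { refl → j≢i refl }))
        (+-shiftʳ {f (v i)} {g (v i)} {∑[ l < 4 ] f (w i l)} {∑[ l < 4 ] g (w i l)}
          (agree (v i) λ ())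
          (∑-shift l (λ l' l'≢l → agree (w i l') λ { refl → l'≢l refl }) e)))

  weight : (V n m → ℕ) → Config n m → ℕ
  weight c S = ∑V (λ z → if S z then c z else 0)

  weight-add : ∀ c {S S' : Config n m} {x} → (∀ z → z ≢ x → S z ≡ S' z) →
               S x ≡ false → S' x ≡ true → weight c S + c x ≡ weight c S'
  weight-add c {S} {S'} {x} agree Sx S'x =
    trans (∑V-shift x (λ z z≢x → cong (λ b → if b then c z else 0) (agree z z≢x)) shift)
          (+-identityʳ (weight c S'))
    where
      shift : (if S x then c x else 0) + c x ≡ (if S' x then c x else 0) + 0
      shift rewrite Sx | S'x = sym (+-identityʳ (c x))

module _ {n m : ℕ} (X : Fin m → Subset (3 * n)) where

  source target : ∀ {S S'} → Move {n} X S S' → V n m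
  source = proj₁
  target mv = proj₁ (proj₂ mv)

  occupied-before : ∀ {S S' z} (mv : Move {n} X S S') → z ≢ target mv → S' z ≡ true → S z ≡ true
  occupied-before {z = z} (x , _ , Sx , _ , _ , _ , _ , frame) z≢y S'z with z ≟V x
  ... | yes refl = Sx
  ... | no z≢x = trans (sym (frame z z≢x z≢y)) S'z

  vacant-after : ∀ {S S' z} (mv : Move {n} X S S') → z ≢ target mv → S z ≡ false → S' z ≡ false
  vacant-after {z = z} (x , _ , _ , _ , _ , S'x , _ , frame) z≢y Sz with z ≟V x
  ... | yes refl = S'x
  ... | no z≢x = trans (frame z z≢x z≢y) Sz

  weight-move : ∀ c {S S'} (mv : Move {n} X S S') →
                weight c S' + c (source mv) ≡ weight c S + c (target mv)
  weight-move c {S} {S'} (x , y , Sx , Sy , _ , S'x , S'y , frame) = begin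
    weight c S' + c x  ≡⟨ weight-add c S'≡U-off-x S'x (trans (≔-other S true x≢y) Sx) ⟩
    weight c U         ≡⟨ weight-add c (λ z z≢y → sym (≔-other S true z≢y)) Sy (≔-same S y true) ⟨
    weight c S + c y   ∎
    where
      open ≡-Reasoning
      x≢y = occupied≢vacant {S = S} Sx Sy
      -- S and S' each differ from U at a single vertex.
      U = S [ y ]≔ true
      S'≡U-off-x : ∀ z → z ≢ x → S' z ≡ U z
      S'≡U-off-x z z≢x with z ≟V y
      ... | yes refl = S'y
      ... | no z≢y = frame z z≢x z≢y

  reach-trans : ∀ {a b S S' S''} →
                Reach {n} X a S S' → Reach {n} X b S' S'' → Reach {n} X (a + b) S S''
  reach-trans done r = r
  reach-trans (step mv r) r' = step mv (reach-trans r r')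

  size : Config n m → ℕ
  size = weight (λ _ → 1)

  size-reach : ∀ {ℓ S S'} → Reach {n} X ℓ S S' → size S' ≡ size S
  size-reach done = refl
  size-reach (step mv r) = trans (size-reach r) (+-cancelʳ-≡ 1 _ _ (weight-move (λ _ → 1) mv))

  module Potential (c : V n m → ℕ) (c-edge : ∀ {x y} → Adj X x y → c y ≤ suc (c x)) where

    move-≤ : ∀ {S S'} → Move {n} X S S' → weight c S' ≤ suc (weight c S)
    move-≤ {S} {S'} mv@(x , y , _ , _ , adj , _) = +-cancelʳ-≤ (c x) _ _ (begin
      weight c S' + c x       ≡⟨ weight-move c mv ⟩
      weight c S + c y        ≤⟨ +-monoʳ-≤ (weight c S) (c-edge adj) ⟩
      weight c S + suc (c x)  ≡⟨ +-suc (weight c S) (c x) ⟩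
      suc (weight c S) + c x  ∎)
      where open ≤-Reasoning

    tight-move : ∀ {S S'} (mv : Move {n} X S S') → weight c S' ≡ suc (weight c S) →
                 c (target mv) ≡ suc (c (source mv))
    tight-move {S} {S'} mv@(x , y , _) up = +-cancelˡ-≡ (weight c S) _ _ (begin
      weight c S + c y        ≡⟨ weight-move c mv ⟨
      weight c S' + c x       ≡⟨ cong (_+ c x) up ⟩
      suc (weight c S) + c x  ≡⟨ +-suc (weight c S) (c x) ⟨
      weight c S + suc (c x)  ∎)
      where open ≡-Reasoning

    reach-≤ : ∀ {ℓ S S'} → Reach {n} X ℓ S S' → weight c S' ≤ weight c S + ℓ
    reach-≤ {S = S} done = ≤-reflexive (sym (+-identityʳ (weight c S)))
    reach-≤ {suc ℓ} {S} {S''} (step {S' = S'} mv r) = begin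
      weight c S''          ≤⟨ reach-≤ r ⟩
      weight c S' + ℓ       ≤⟨ +-monoˡ-≤ ℓ (move-≤ mv) ⟩
      suc (weight c S) + ℓ  ≡⟨ +-suc (weight c S) ℓ ⟨
      weight c S + suc ℓ    ∎
      where open ≤-Reasoning

    reach-tight : ∀ {P : Config n m → Set} →
                  (∀ {S S'} (mv : Move {n} X S S') →
                     c (target mv) ≡ suc (c (source mv)) → P S → P S') →
                  ∀ {ℓ S S'} → Reach {n} X ℓ S S' →
                  weight c S' ≡ weight c S + ℓ → P S → P S'
    reach-tight preserve done _ PS = PS
    reach-tight preserve {suc ℓ} {S} {S''} (step {S' = S'} mv r) tight PS =
      reach-tight preserve r tight' (preserve mv (tight-move mv up) PS)
      where
        open ≤-Reasoning
        up : weight c S' ≡ suc (weight c S)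
        up = ≤-antisym (move-≤ mv) (+-cancelʳ-≤ ℓ _ _ (begin
          suc (weight c S) + ℓ  ≡⟨ +-suc (weight c S) ℓ ⟨
          weight c S + suc ℓ    ≡⟨ tight ⟨
          weight c S''          ≤⟨ reach-≤ r ⟩
          weight c S' + ℓ       ∎))
        tight' : weight c S'' ≡ weight c S' + ℓ
        tight' = trans tight (trans (+-suc (weight c S) ℓ) (cong (_+ ℓ) (sym up)))

  moveToken-move : ∀ {S x y} → S x ≡ true → S y ≡ false → Adj X x y →
                   Move {n} X S (moveToken S x y)
  moveToken-move {S} {x} {y} Sx Sy adj =
    x , y , Sx , Sy , adj , trans (≔-other (S [ x ]≔ false) true x≢y) (≔-same S x false) ,
    ≔-same (S [ x ]≔ false) y true , λ _ → moveToken-other {S = S}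
    where x≢y = occupied≢vacant {S = S} Sx Sy

  record Slides {K} (S : Config n m) (s t : Fin K → V n m) : Set where
    field
      edge             : ∀ k → Adj X (s k) (t k)
      source-injective : Injective _≡_ _≡_ s
      target-injective : Injective _≡_ _≡_ t
      source-occupied  : ∀ k → S (s k) ≡ true
      target-vacant    : ∀ k → S (t k) ≡ false

  record Slid {K} (S : Config n m) (s t : Fin K → V n m) (T : Subset K) : Set where
    field
      final    : Config n m
      reach    : Reach {n} X ∣ T ∣ S final
      filled   : ∀ {k} → k ∈ T → final (t k) ≡ true
      unmoved  : ∀ z → (∀ {k} → k ∈ T → z ≢ s k) → (∀ {k} → k ∈ T → z ≢ t k) →
                 final z ≡ S z

  slides-tail : ∀ {K S S'} {s t : Fin (suc K) → V n m} → Slides S s t →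
                (∀ k → S' (s (suc k)) ≡ S (s (suc k))) →
                (∀ k → S' (t (suc k)) ≡ S (t (suc k))) →
                Slides S' (s ∘ suc) (t ∘ suc)
  slides-tail sl keep-s keep-t = record
    { edge             = edge ∘ suc
    ; source-injective = λ e → suc-injective (source-injective e)
    ; target-injective = λ e → suc-injective (target-injective e)
    ; source-occupied  = λ k → trans (keep-s k) (source-occupied (suc k))
    ; target-vacant    = λ k → trans (keep-t k) (target-vacant (suc k))
    }
    where open Slides sl

  slide : ∀ {K S} {s t : Fin K → V n m} → Slides S s t → (T : Subset K) → Slid S s t T
  slide {S = S} _ [] = record { final = S ; reach = done ; filled = λ () ; unmoved = λ _ _ _ → refl }
  slide {S = S} sl (false ∷ T) = record
    { final   = final
    ; reach   = reach
    ; filled  = λ { (there k∈T) → filled k∈T }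
    ; unmoved = λ z ∉s ∉t → unmoved z (λ k∈T → ∉s (there k∈T)) (λ k∈T → ∉t (there k∈T))
    }
    where open Slid (slide (slides-tail {S' = S} sl (λ _ → refl) (λ _ → refl)) T)
  slide {S = S} {s} {t} sl (true ∷ T) = record
    { final   = final
    ; reach   = step (moveToken-move (source-occupied zero) (target-vacant zero) (edge zero)) reach
    ; filled  = λ { here → trans (unmoved (t zero) t₀∉s t₀∉t)
                                  (≔-same (S [ s zero ]≔ false) (t zero) true)
                  ; (there k∈T) → filled k∈T }
    ; unmoved = λ z ∉s ∉t →
        trans (unmoved z (λ k∈T → ∉s (there k∈T)) (λ k∈T → ∉t (there k∈T)))
              (moveToken-other {S = S} (∉s here) (∉t here))
    }
    where
      open Slides sl
      S₁ = moveToken S (s zero) (t zero)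
      keep-s : ∀ k → S₁ (s (suc k)) ≡ S (s (suc k))
      keep-s k = moveToken-other {S = S}
                   (λ e → contradiction (source-injective e) λ ())
                   (occupied≢vacant {S = S} (source-occupied (suc k)) (target-vacant zero))
      keep-t : ∀ k → S₁ (t (suc k)) ≡ S (t (suc k))
      keep-t k = moveToken-other {S = S}
                   (λ e → occupied≢vacant {S = S} (source-occupied zero) (target-vacant (suc k)) (sym e))
                   (λ e → contradiction (target-injective e) λ ())
      open Slid (slide (slides-tail {S' = S₁} sl keep-s keep-t) T)
      t₀∉s : ∀ {k} → k ∈ T → t zero ≢ s (suc k)
      t₀∉s {k} _ e = occupied≢vacant {S = S} (source-occupied (suc k)) (target-vacant zero) (sym e)
      t₀∉t : ∀ {k} → k ∈ T → t zero ≢ t (suc k)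
      t₀∉t _ e = contradiction (target-injective e) λ ()

  vertex-cover : ∀ {C : Config n m} → (∀ u → C (q (suc u)) ≡ true) →
                 (∀ i → C (v i) ≡ true ⊎ (∀ l → C (w i l) ≡ true)) → IsVertexCover X C
  vertex-cover _ _ (q zero) (q zero) (qq 0≢0) = contradiction refl 0≢0
  vertex-cover elements _ (q zero) (q (suc b)) (qq _) = inj₂ (elements b)
  vertex-cover elements _ (q (suc a)) (q _) (qq _) = inj₁ (elements a)
  vertex-cover elements _ _ _ (vq {j = j} _) = inj₂ (elements j)
  vertex-cover elements _ _ _ (qv {j = j} _) = inj₁ (elements j)
  vertex-cover elements _ _ _ (wq {j = j} _) = inj₂ (elements j)
  vertex-cover elements _ _ _ (qw {j = j} _) = inj₁ (elements j)
  vertex-cover _ gadget _ _ (wv {i} {l}) = [ inj₂ , (λ leaves → inj₁ (leaves l)) ] (gadget i)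
  vertex-cover _ gadget _ _ (vw {i} {l}) = [ inj₁ , (λ leaves → inj₂ (leaves l)) ] (gadget i)

  opposite-occupied : ∀ {C : Config n m} {x y} →
                      IsVertexCover X C → Adj X x y → C x ≡ false → C y ≡ true
  opposite-occupied {x = x} {y} cover adj Cx =
    [ (λ Cx≡true → contradiction (trans (sym Cx) Cx≡true) λ ()) , id ] (cover x y adj)

  level : V n m → ℕ
  level (q zero) = 2
  level (q (suc _)) = 1
  level (v _) = 1
  level (w _ _) = 0

  level-q≤2 : ∀ a → level (q a) ≤ 2
  level-q≤2 zero = ≤-refl
  level-q≤2 (suc _) = s≤s z≤n

  level-edge : ∀ {x y} → Adj X x y → level y ≤ suc (level x)
  level-edge (qq {a = zero} {b} _) = m≤n⇒m≤1+n (level-q≤2 b)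
  level-edge (qq {a = suc _} {b} _) = level-q≤2 b
  level-edge (vq _) = s≤s z≤n
  level-edge (qv _) = s≤s z≤n
  level-edge wv = ≤-refl
  level-edge vw = z≤n
  level-edge (wq _) = ≤-refl
  level-edge (qw _) = z≤n

  Traced : Config n m → Set
  Traced S = ∀ u → S (q (suc u)) ≡ true → ∃[ i ] (u ∈ X i × ∃[ l ] (S (w i l) ≡ false))

  traced-step : ∀ {S S'} (mv : Move {n} X S S') → level (target mv) ≡ suc (level (source mv)) →
                Traced S → Traced S'
  traced-step {S' = S'} mv@(x , y , _ , _ , adj , S'x , _) tight traced u S'qu with q (suc u) ≟V y
  ... | yes refl = entered-from-leaf {S' = S'} adj tight S'x
    where
      entered-from-leaf : ∀ {x} {S' : Config n m} → Adj X x (q (suc u)) → 1 ≡ suc (level x) →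
                          S' x ≡ false → ∃[ i ] (u ∈ X i × ∃[ l ] (S' (w i l) ≡ false))
      entered-from-leaf (qq {a = zero} _) ()
      entered-from-leaf (qq {a = suc _} _) ()
      entered-from-leaf (vq _) ()
      entered-from-leaf (wq u∈Xi) _ S'x = _ , u∈Xi , _ , S'x
  ... | no qu≢y with traced u (occupied-before mv qu≢y S'qu)
  ...   | i , u∈Xi , l , leaf-vacant =
    i , u∈Xi , l , vacant-after mv (λ e → 0≢1+n (trans (cong level e) tight)) leaf-vacant

module FromCover {n m : ℕ} (X : Fin m → Subset (3 * n)) (|X|≡3 : ∀ i → ∣ X i ∣ ≡ 3)
                 (T : Subset m) (covers : ∀ u → ∃[ i ] (i ∈ T × u ∈ X i)) where

  chosen : Fin (3 * n) → Fin m
  chosen u = proj₁ (covers u)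

  chosen∈T : ∀ u → chosen u ∈ T
  chosen∈T u = proj₁ (proj₂ (covers u))

  ∈-chosen : ∀ u → u ∈ X (chosen u)
  ∈-chosen u = proj₂ (proj₂ (covers u))

  -- Leaf 0 of each gadget is kept for the slide onto v_i; the element u uses the leaf
  -- following its rank in X i.
  ranked-leaf : ∀ {i u} → u ∈ X i → V n m
  ranked-leaf {i} u∈Xi = w i (suc (cast (|X|≡3 i) (rank (X i) u∈Xi)))

  ranked-leaf-injective : ∀ {i i' u u'} (u∈Xi : u ∈ X i) (u'∈Xi' : u' ∈ X i') →
                          ranked-leaf u∈Xi ≡ ranked-leaf u'∈Xi' → u ≡ u'
  ranked-leaf-injective {i} u∈Xi u'∈Xi' e with w-injective e
  ... | refl , slot≡ = rank-injective (X i) u∈Xi u'∈Xi' (toℕ-injective (begin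
    toℕ (rank (X i) u∈Xi)                       ≡⟨ toℕ-cast (|X|≡3 i) _ ⟨
    toℕ (cast (|X|≡3 i) (rank (X i) u∈Xi))      ≡⟨ cong toℕ (suc-injective slot≡) ⟩
    toℕ (cast (|X|≡3 i) (rank (X i) u'∈Xi'))    ≡⟨ toℕ-cast (|X|≡3 i) _ ⟩
    toℕ (rank (X i) u'∈Xi')                     ∎))
    where open ≡-Reasoning

  leaf : Fin (3 * n) → V n m
  leaf u = ranked-leaf (∈-chosen u)

  select-sets : Slides {n} X initS (λ i → w i zero) v
  select-sets = record
    { edge             = λ _ → wv
    ; source-injective = λ { refl → refl }
    ; target-injective = λ { refl → refl }
    ; source-occupied  = λ _ → refl
    ; target-vacant    = λ _ → refl
    }

  open Slid (slide {n} X select-sets T)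
    renaming (final to C₁; reach to reach₁; filled to filled₁; unmoved to unmoved₁)

  fill-elements : Slides {n} X C₁ leaf (q ∘ suc)
  fill-elements = record
    { edge             = λ u → wq (∈-chosen u)
    ; source-injective = λ {u} {u'} → ranked-leaf-injective (∈-chosen u) (∈-chosen u')
    ; target-injective = λ { refl → refl }
    ; source-occupied  = λ u → unmoved₁ (leaf u) (λ _ ()) (λ _ ())
    ; target-vacant    = λ u → unmoved₁ (q (suc u)) (λ _ ()) (λ _ ())
    }

  open Slid (slide {n} X fill-elements ⊤)
    renaming (final to C₂; reach to reach₂; filled to filled₂; unmoved to unmoved₂)

  unselected-leaf : ∀ {i i' l l'} → i ∉ T → i' ∈ T → w {n} i l ≢ w i' l'
  unselected-leaf i∉T i'∈T e = i∉T (subst (_∈ T) (sym (proj₁ (w-injective e))) i'∈T)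

  gadget-covered : ∀ i → C₂ (v i) ≡ true ⊎ (∀ l → C₂ (w i l) ≡ true)
  gadget-covered i with i ∈? T
  ... | yes i∈T = inj₁ (trans (unmoved₂ (v i) (λ _ ()) (λ _ ())) (filled₁ i∈T))
  ... | no i∉T = inj₂ λ l →
    trans (unmoved₂ (w i l) (λ {u} _ → unselected-leaf i∉T (chosen∈T u)) (λ _ ()))
          (unmoved₁ (w i l) (unselected-leaf i∉T) (λ _ ()))

  reconfiguration : ∣ T ∣ ≡ n →
                    ∃[ ℓ ] ∃[ C ] (ℓ ≤ 4 * n × Reach {n} X ℓ initS C × IsVertexCover {n} X C)
  reconfiguration |T|≡n =
    ∣ T ∣ + ∣ ⊤ {3 * n} ∣ , C₂ , ≤-reflexive (cong₂ _+_ |T|≡n (∣⊤∣≡n (3 * n))) ,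
    reach-trans {n} X reach₁ reach₂ , vertex-cover {n} X (λ u → filled₂ ∈⊤) gadget-covered

tight-budget : ∀ {b k t ℓ n} → 3 * n ≤ k → k ≤ 3 * t → b + k + t ≤ ℓ → ℓ ≤ 4 * n →
               b ≡ 0 × t ≡ n × b + k + t ≡ ℓ
tight-budget {b} {k} {t} {ℓ} {n} 3n≤k k≤3t spent≤ℓ ℓ≤4n =
  n≤0⇒n≡0 (+-cancelʳ-≤ (k + t) b 0 b+[k+t]≤k+t) ,
  ≤-antisym t≤n n≤t ,
  ≤-antisym spent≤ℓ ℓ≤spent
  where
    open ≤-Reasoning
    n≤t : n ≤ t
    n≤t = *-cancelˡ-≤ 3 (≤-trans 3n≤k k≤3t)
    4n≤k+t : 4 * n ≤ k + t
    4n≤k+t = begin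
      4 * n      ≡⟨ +-comm n (3 * n) ⟩
      3 * n + n  ≤⟨ +-mono-≤ 3n≤k n≤t ⟩
      k + t      ∎
    b+[k+t]≤4n : b + (k + t) ≤ 4 * n
    b+[k+t]≤4n = begin
      b + (k + t)  ≡⟨ +-assoc b k t ⟨
      b + k + t    ≤⟨ spent≤ℓ ⟩
      ℓ            ≤⟨ ℓ≤4n ⟩
      4 * n        ∎
    b+[k+t]≤k+t : b + (k + t) ≤ k + t
    b+[k+t]≤k+t = ≤-trans b+[k+t]≤4n 4n≤k+t
    t≤n : t ≤ n
    t≤n = +-cancelˡ-≤ (3 * n) t n (begin
      3 * n + t    ≤⟨ +-monoˡ-≤ t 3n≤k ⟩
      k + t        ≤⟨ m≤n+m (k + t) b ⟩
      b + (k + t)  ≤⟨ b+[k+t]≤4n ⟩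
      4 * n        ≡⟨ +-comm n (3 * n) ⟩
      3 * n + n    ∎)
    ℓ≤spent : ℓ ≤ b + k + t
    ℓ≤spent = begin
      ℓ            ≤⟨ ℓ≤4n ⟩
      4 * n        ≤⟨ 4n≤k+t ⟩
      k + t        ≤⟨ m≤n+m (k + t) b ⟩
      b + (k + t)  ≡⟨ +-assoc b k t ⟨
      b + k + t    ∎

module ToCover {n m : ℕ} (X : Fin m → Subset (3 * n)) {ℓ} {C : Config n m} (ℓ≤4n : ℓ ≤ 4 * n)
               (reach : Reach {n} X ℓ initS C) (cover : IsVertexCover {n} X C) where

  open Potential {n} X (level {n} X) (level-edge {n} X)

  on-clique selected : ℕ
  on-clique = count (λ a → C (q a))
  selected = count (λ i → C (v i))

  gadget-tokens : Fin m → ℕ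
  gadget-tokens i = ⟦ C (v i) ⟧ + count (λ l → C (w i l))

  gadget-bound : ∀ i → 4 ≤ 3 * ⟦ C (v i) ⟧ + gadget-tokens i
  gadget-bound i with C (v i) in vi
  ... | true = s≤s (s≤s (s≤s (s≤s z≤n)))
  ... | false = ≤-reflexive (sym (count-all λ l → opposite-occupied {n} X cover (vw {l = l}) vi))

  on-clique≤3·selected : on-clique ≤ 3 * selected
  on-clique≤3·selected = +-cancelʳ-≤ (sum gadget-tokens) on-clique (3 * selected) (begin
    on-clique + sum gadget-tokens
      ≡⟨ size-reach {n} X reach ⟩
    size {n} X initS
      ≡⟨ cong (_+ ∑[ i < m ] 4) (sum-replicate-zero (suc (3 * n))) ⟩
    ∑[ i < m ] 4
      ≤⟨ ∑-mono gadget-bound ⟩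
    ∑[ i < m ] (3 * ⟦ C (v i) ⟧ + gadget-tokens i)
      ≡⟨ ∑-distrib-+ (λ i → 3 * ⟦ C (v i) ⟧) gadget-tokens ⟩
    ∑[ i < m ] (3 * ⟦ C (v i) ⟧) + sum gadget-tokens
      ≡⟨ cong (_+ sum gadget-tokens) (*-distribˡ-sum 3 (λ i → ⟦ C (v i) ⟧)) ⟨
    3 * selected + sum gadget-tokens
      ∎)
    where open ≤-Reasoning

  3n≤on-clique : 3 * n ≤ on-clique
  3n≤on-clique = clique-cover-count (λ a → C (q a)) (λ a b a≢b → cover (q a) (q b) (qq a≢b))

  level-initS : weight (level {n} X) initS ≡ 0
  level-initS = cong₂ _+_ (sum-replicate-zero (suc (3 * n))) (sum-replicate-zero m)

  level-C : weight (level {n} X) C ≡ ⟦ C (q zero) ⟧ + on-clique + selected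
  level-C = cong₂ _+_ clique-part (sum-cong-≗ λ i →
              trans (cong (⟦ C (v i) ⟧ +_) (leaves-weightless i)) (+-identityʳ _))
    where
      clique-part : (if C (q zero) then 2 else 0) + count (λ u → C (q (suc u))) ≡
                    ⟦ C (q zero) ⟧ + on-clique
      clique-part with C (q zero)
      ... | true = refl
      ... | false = refl
      leaves-weightless : ∀ i → ∑[ l < 4 ] (if C (w i l) then 0 else 0) ≡ 0
      leaves-weightless i =
        trans (sum-cong-≗ {x = λ l → if C (w i l) then 0 else 0} λ l → if-eta (C (w i l)))
              (sum-replicate-zero 4)

  level-C≤ℓ : ⟦ C (q zero) ⟧ + on-clique + selected ≤ ℓ
  level-C≤ℓ = subst₂ _≤_ level-C (cong (_+ ℓ) level-initS) (reach-≤ reach)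

  budget : ⟦ C (q zero) ⟧ ≡ 0 × selected ≡ n × ⟦ C (q zero) ⟧ + on-clique + selected ≡ ℓ
  budget = tight-budget 3n≤on-clique on-clique≤3·selected level-C≤ℓ ℓ≤4n

  q₀-vacant : C (q zero) ≡ false
  q₀-vacant with C (q zero) | proj₁ budget
  ... | false | _ = refl
  ... | true | ()

  traced : Traced {n} X C
  traced = reach-tight (traced-step {n} X) reach
             (trans level-C (trans (proj₂ (proj₂ budget)) (cong (_+ ℓ) (sym level-initS))))
             (λ _ ())

  hasCover : HasCover {n} X
  hasCover = tabulate (λ i → C (v i)) ,
             trans (∣tabulate∣≡count (λ i → C (v i))) (proj₁ (proj₂ budget)) ,
             covered
    where
      covered : ∀ u → ∃[ i ] (i ∈ tabulate (λ i → C (v i)) × u ∈ X i)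
      covered u with traced u (opposite-occupied {n} X cover (qq λ ()) q₀-vacant)
      ... | i , u∈Xi , l , leaf-vacant =
        i , ∈-tabulate (opposite-occupied {n} X cover wv leaf-vacant) , u∈Xi

lemma2 : (n m : ℕ) (X : Fin m → Subset (3 * n)) → (∀ i → ∣ X i ∣ ≡ 3) →
    HasCover {n} X ⇔ (∃[ ℓ ] ∃[ C ] (ℓ ≤ 4 * n × Reach {n} X ℓ initS C × IsVertexCover {n} X C))
lemma2 n m X |X|≡3 = mk⇔
  (λ (T , |T|≡n , covers) → FromCover.reconfiguration X |X|≡3 T covers |T|≡n)
  (λ (_ , _ , ℓ≤4n , reach , cover) → ToCover.hasCover X ℓ≤4n reach cover)
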